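{- Let $G=(V,E)$ be a $2$-vertex-connected directed graph, let $C^{2vt}$ be a $2$-vertex-twinless-connected component of $G$, and let $v$ be a twinless articulation point of $G$. Then $C^{2vt}\setminus\{v\}$ is a subset of a twinless strongly connected component of $G\setminus\{v\}$.
   Context: Directed graphs are finite with no loops and no parallel edges. For $U\subseteq V$, $G[U]$ is the induced subgraph and $G\setminus\{v\}=G[V\setminus\{v\}]$. A directed graph is twinless strongly connected if for every pair of vertices $a,b$ there is a directed path $p$ from $a$ to $b$ and a directed path $q$ from $b$ to $a$ such that for every edge $(c,d)$ of $p$, the edge $(d,c)$ is not an edge of $q$. In a directed graph $H$, two vertices are twinless strongly connected if such paths exist in $H$; the equivalence classes are the twinless strongly connected components of $H$. A twinless articulation point of $G$ is a vertex $v$ such that $G\setminus\{v\}$ is not twinless strongly connected. A directed graph $H=(W,F)$ is $2$-vertex-connected if it is strongly connected, $|W|\ge3$, and $H[W\setminus\{x\}]$ is strongly connected for all $x\in W$; it is $2$-vertex-twinless-connected if it is twinless strongly connected, $|W|\ge 3$, and $H[W\setminus\{x\}]$ is twinless strongly connected for all $x\in W$. A $2$-vertex-twinless-connected component of $G$ is a maximal set $U\subseteq V$ such that $G[U]$ is $2$-vertex-twinless-connected. -}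

module Defs where

open import Data.Nat using (ℕ)
open import Data.Fin using (Fin)
open import Data.List using (List; []; _∷_)
open import Data.List.Relation.Unary.Unique.Propositional using (Unique)
open import Data.Product using (Σ; ∃; ∃-syntax; _×_; _,_)
open import Data.Empty using (⊥)
open import Data.Unit using (⊤)
open import Relation.Nullary using (¬_)
open import Relation.Binary.PropositionalEquality using (_≡_; _≢_)
open import Function.Bundles using (_⇔_)

-- A finite directed graph on vertex set Fin n; edges form a relation,
-- so there are no parallel edges; loops are excluded explicitly.
record Digraph : Set₁ where
  field
    n      : ℕ
    Edge   : Fin n → Fin n → Set
    noLoop : ∀ x → ¬ Edge x x
open Digraph public

VSet : Digraph → Set₁
VSet G = Fin (n G) → Set

allV : (G : Digraph) → VSet G
allV G _ = ⊤

_∖_ : {G : Digraph} → VSet G → Fin (n G) → VSet G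
(U ∖ v) x = U x × x ≢ v

_⊆_ : {G : Digraph} → VSet G → VSet G → Set
U ⊆ W = ∀ x → U x → W x

module _ (G : Digraph) where

  data Walk (U : VSet G) : Fin (n G) → Fin (n G) → Set where
    [_]  : ∀ {a} → U a → Walk U a a
    _∷⟨_⟩_ : ∀ {a b c} → U a → Edge G a b → Walk U b c → Walk U a c

  vertices : ∀ {U a b} → Walk U a b → List (Fin (n G))
  vertices {a = a} [ _ ] = a ∷ []
  vertices {a = a} (_ ∷⟨ _ ⟩ w) = a ∷ vertices w

  IsPath : ∀ {U a b} → Walk U a b → Set
  IsPath w = Unique (vertices w)

  data EdgeOf {U : VSet G} : ∀ {a b} → Walk U a b → Fin (n G) → Fin (n G) → Set where
    here  : ∀ {a b c} (u : U a) (e : Edge G a b) (w : Walk U b c) → EdgeOf (u ∷⟨ e ⟩ w) a b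
    there : ∀ {a b c x y} (u : U a) (e : Edge G a b) (w : Walk U b c) →
            EdgeOf w x y → EdgeOf (u ∷⟨ e ⟩ w) x y

  StronglyConnected : VSet G → Set
  StronglyConnected U = ∀ a b → U a → U b → Σ (Walk U a b) IsPath

  TwinlessConn : VSet G → Fin (n G) → Fin (n G) → Set
  TwinlessConn U a b =
    Σ (Walk U a b) λ p → Σ (Walk U b a) λ q →
      IsPath p × IsPath q × (∀ c d → EdgeOf p c d → ¬ EdgeOf q d c)

  TwinlessStronglyConnected : VSet G → Set
  TwinlessStronglyConnected U = ∀ a b → U a → U b → TwinlessConn U a b

  AtLeast3 : VSet G → Set
  AtLeast3 U = ∃[ x ] ∃[ y ] ∃[ z ] (U x × U y × U z × x ≢ y × y ≢ z × x ≢ z)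

  TwoVertexConnected : VSet G → Set
  TwoVertexConnected U =
    StronglyConnected U × AtLeast3 U × (∀ x → U x → StronglyConnected (_∖_ {G} U x))

  TwoVertexTwinlessConnected : VSet G → Set
  TwoVertexTwinlessConnected U =
    TwinlessStronglyConnected U × AtLeast3 U ×
    (∀ x → U x → TwinlessStronglyConnected (_∖_ {G} U x))

  Is2VTCComponent : VSet G → Set₁
  Is2VTCComponent C =
    TwoVertexTwinlessConnected C ×
    (∀ (D : VSet G) → _⊆_ {G} C D → TwoVertexTwinlessConnected D → _⊆_ {G} D C)

  TwinlessArticulationPoint : Fin (n G) → Set
  TwinlessArticulationPoint v = ¬ TwinlessStronglyConnected (_∖_ {G} (allV G) v)

  -- K is a twinless strongly connected component of G[U]: an equivalence
  -- class of the twinless-strong-connectivity relation on U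
  IsTSCC : VSet G → VSet G → Set
  IsTSCC U K = ∃[ w ] (U w × (∀ x → K x ⇔ (U x × TwinlessConn U w x)))

module Submission where

-- The key observation is that C ∖ {v} is twinless strongly connected as an
-- induced subgraph, whether or not v lies in C:
--   * if v ∈ C this is the definition of 2-vertex-twinless-connectivity;
--   * if v ∉ C, the twinless path pair joining two vertices of C inside G[C]
--     cannot visit v, so it already lives in G[C ∖ {v}].
-- Since C ∖ {v} ⊆ V ∖ {v}, and twinless connectivity is monotone in the
-- ambient vertex set, all of C ∖ {v} lies in the twinless strongly connected
-- component of G ∖ {v} containing any fixed vertex w ∈ C ∖ {v} (which exists
-- because |C| ≥ 3).

open import Defs
open import Data.Fin using (Fin)
open import Data.Fin.Properties using (_≟_)
open import Data.Product using (Σ; ∃-syntax; _×_; _,_)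
open import Data.List using (_∷_)
open import Data.Sum using (_⊎_; inj₁; inj₂)
open import Data.List.Membership.Propositional using (_∈_)
import Data.List.Membership.DecPropositional as DecMembership
open import Data.List.Relation.Unary.Any using (here; there)
open import Data.List.Relation.Unary.Unique.Propositional using (Unique)
open import Data.Unit using (tt)
open import Relation.Nullary using (¬_; yes; no)
open import Relation.Binary.PropositionalEquality using (_≡_; refl; sym; cong; subst)
open import Function.Bundles using (mk⇔)

module _ (G : Digraph) where

  open DecMembership (_≟_ {n G}) using (_∈?_)

  visited-in : ∀ {U : VSet G} {a b} (w : Walk G U a b) →
    ∀ y → y ∈ vertices G w → U y
  visited-in [ u ]          y (here refl) = u
  visited-in (u ∷⟨ _ ⟩ _)   y (here refl) = u
  visited-in (_ ∷⟨ _ ⟩ w)   y (there m)   = visited-in w y m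

  transfer-walk : ∀ {U₁ U₂ : VSet G} {a b} (w : Walk G U₁ a b) →
    (∀ y → y ∈ vertices G w → U₂ y) →
    Σ (Walk G U₂ a b) λ w′ → (vertices G w′ ≡ vertices G w) ×
      (∀ c d → EdgeOf G w′ c d → EdgeOf G w c d)
  transfer-walk [ _ ] inU₂ = [ inU₂ _ (here refl) ] , refl , λ _ _ ()
  transfer-walk (u ∷⟨ e ⟩ w) inU₂
    with transfer-walk w (λ y m → inU₂ y (there m))
  ... | w′ , same-vertices , edges-back =
    (inU₂ _ (here refl) ∷⟨ e ⟩ w′) , cong (_ ∷_) same-vertices , edges-of
    where
    edges-of : ∀ c d → EdgeOf G (inU₂ _ (here refl) ∷⟨ e ⟩ w′) c d →
               EdgeOf G (u ∷⟨ e ⟩ w) c d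
    edges-of _ _ (here _ _ _)      = here u e w
    edges-of c d (there _ _ _ ce)  = there u e w (edges-back c d ce)

  transfer-twinless : ∀ {U₁ U₂ : VSet G} {a b}
    (t@(p , q , _) : TwinlessConn G U₁ a b) →
    (∀ y → y ∈ vertices G p → U₂ y) →
    (∀ y → y ∈ vertices G q → U₂ y) → TwinlessConn G U₂ a b
  transfer-twinless (p , q , p-path , q-path , twinless) p-in q-in
    with transfer-walk p p-in | transfer-walk q q-in
  ... | p′ , p-same , p-edges | q′ , q-same , q-edges =
    p′ , q′ , subst Unique (sym p-same) p-path , subst Unique (sym q-same) q-path ,
    λ c d cd dc → twinless c d (p-edges c d cd) (q-edges d c dc)

  twinless-mono : ∀ {U₁ U₂ : VSet G} {a b} → _⊆_ {G} U₁ U₂ →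
    TwinlessConn G U₁ a b → TwinlessConn G U₂ a b
  twinless-mono U₁⊆U₂ t@(p , q , _) =
    transfer-twinless t (λ y m → U₁⊆U₂ y (visited-in p y m))
                        (λ y m → U₁⊆U₂ y (visited-in q y m))

  visits-or-avoids : ∀ {U : VSet G} {a b} (v : Fin (n G)) →
    TwinlessConn G U a b → U v ⊎ TwinlessConn G (_∖_ {G} U v) a b
  visits-or-avoids {U} v t@(p , q , _) with v ∈? vertices G p | v ∈? vertices G q
  ... | yes v∈p | _       = inj₁ (visited-in p v v∈p)
  ... | no _    | yes v∈q = inj₁ (visited-in q v v∈q)
  ... | no v∉p  | no v∉q  =
    inj₂ (transfer-twinless t (avoiding p v∉p) (avoiding q v∉q))
    where
    avoiding : ∀ {a b} (w : Walk G U a b) → ¬ v ∈ vertices G w →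
      ∀ y → y ∈ vertices G w → _∖_ {G} U v y
    avoiding w v∉w y y∈w = visited-in w y y∈w , λ { refl → v∉w y∈w }

  twinless-after-removal : ∀ {C : VSet G} → TwoVertexTwinlessConnected G C →
    ∀ v → TwinlessStronglyConnected G (_∖_ {G} C v)
  twinless-after-removal (tsc , _ , tsc-minus) v a b (a∈C , a≢v) (b∈C , b≢v)
    with visits-or-avoids v (tsc a b a∈C b∈C)
  ... | inj₁ v∈C      = tsc-minus v v∈C a b (a∈C , a≢v) (b∈C , b≢v)
  ... | inj₂ avoiding = avoiding

  survivor : ∀ {U : VSet G} → AtLeast3 G U → ∀ v → ∃[ w ] (_∖_ {G} U v w)
  survivor (x , y , _ , x∈U , y∈U , _ , x≢y , _) v with x ≟ v
  ... | yes refl = y , y∈U , λ y≡x → x≢y (sym y≡x)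
  ... | no x≢v   = x , x∈U , x≢v

  class-of : (U : VSet G) (w : Fin (n G)) → VSet G
  class-of U w x = U x × TwinlessConn G U w x

  class-is-TSCC : ∀ {U : VSet G} {w} → U w → IsTSCC G U (class-of U w)
  class-is-TSCC {w = w} w∈U = w , w∈U , λ _ → mk⇔ (λ k → k) (λ k → k)

mainTheorem18 : (G : Digraph) → TwoVertexConnected G (allV G) →
    (C : VSet G) → Is2VTCComponent G C →
    (v : Fin (n G)) → TwinlessArticulationPoint G v →
    ∃[ K ] (IsTSCC G (_∖_ {G} (allV G) v) K × _⊆_ {G} (_∖_ {G} C v) K)
mainTheorem18 G _ C (C-2vtc@(_ , C-large , _) , _) v _
  with survivor G C-large v
... | w , w∈C∖v@(_ , w≢v) =
  class-of G G∖v w , class-is-TSCC G (tt , w≢v) , C∖v-in-class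
  where
  G∖v : VSet G
  G∖v = _∖_ {G} (allV G) v

  C∖v⊆G∖v : _⊆_ {G} (_∖_ {G} C v) G∖v
  C∖v⊆G∖v _ (_ , x≢v) = tt , x≢v

  C∖v-in-class : _⊆_ {G} (_∖_ {G} C v) (class-of G G∖v w)
  C∖v-in-class a a∈C∖v =
    C∖v⊆G∖v a a∈C∖v ,
    twinless-mono G C∖v⊆G∖v (twinless-after-removal G C-2vtc v w a w∈C∖v a∈C∖v)
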